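{- Let $G$ be a connected graph of order $n_1\ge 2$ and let $H$ be a graph of order $n_2\ge 2$. Let $\alpha$ be the number of connected components of $H$ of order greater than one and let $\beta$ be the number of isolated vertices of $H$. Then $$pd(G\odot H)\le \begin{cases} pd(G)+n_2-\alpha & \text{if } \alpha\ge 1 \text{ and } \beta\ge 1,\\ pd(G)+n_2-\alpha+1 & \text{if } \alpha\ge 1 \text{ and } \beta=0,\\ pd(G)+n_2 & \text{if } \alpha=0.\end{cases}$$
   Context: For a connected graph $F$ and an ordered partition $\Pi=\{P_1,\dots,P_t\}$ of $V(F)$, $r(v|\Pi)=(d(v,P_1),\dots,d(v,P_t))$ where $d$ is shortest-path distance and $d(v,P_i)=\min_{u\in P_i}d(v,u)$; $\Pi$ is a resolving partition if $r(u|\Pi)\ne r(v|\Pi)$ for all distinct vertices $u,v$; the partition dimension $pd(F)$ is the minimum number of sets in a resolving partition. For graphs $G$ of order $n_1$ (vertices $v_1,\dots,v_{n_1}$) and $H$, the corona product $G\odot H$ is obtained from one copy of $G$ and $n_1$ copies $H_1,\dots,H_{n_1}$ of $H$ by joining $v_i$ to every vertex of $H_i$. -}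

module Defs where

open import Data.Nat using (ℕ; zero; suc; _≤_)
open import Data.Bool using (Bool; true; false; _∧_)
import Data.Bool.Properties as BoolP
open import Data.Fin using (Fin)
open import Data.Fin.Properties using (all?) renaming (_≟_ to _≟F_)
open import Data.List using (List; length; filter)
open import Data.Fin.Base using ()
open import Data.List using ()
import Data.List as L
open import Data.Sum using (_⊎_; inj₁; inj₂)
open import Data.Product using (Σ; ∃; _×_; _,_)
open import Relation.Nullary using (¬_; yes; no; does)
open import Relation.Binary.PropositionalEquality using (_≡_; _≢_; refl; sym)

record Graph (V : Set) : Set where
  field
    adj    : V → V → Bool
    adj-sym : ∀ u v → adj u v ≡ adj v u
    adj-irrefl : ∀ v → adj v v ≡ false
open Graph public

module _ {V : Set} (G : Graph V) where

  data Walk : V → V → ℕ → Set where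
    here : ∀ v → Walk v v zero
    step : ∀ {u w v k} → adj G u w ≡ true → Walk w v k → Walk u v (suc k)

  Reach : V → V → Set
  Reach u v = ∃ λ k → Walk u v k

  Connected : Set
  Connected = ∀ u v → Reach u v

  IsDist : V → V → ℕ → Set
  IsDist u v k = Walk u v k × (∀ m → Walk u v m → k ≤ m)

  -- For an ordered partition given by  part : V → Fin t  (P_i = part⁻¹(i)),
  -- DistToPart part i v k  means  d(v, P_i) = k = min_{u ∈ P_i} d(v,u).
  DistToPart : ∀ {t} → (V → Fin t) → Fin t → V → ℕ → Set
  DistToPart part i v k =
    (∃ λ u → part u ≡ i × Walk v u k) × (∀ u m → part u ≡ i → Walk v u m → k ≤ m)

  record ResolvingPartition (t : ℕ) : Set where
    field
      part     : V → Fin t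
      nonempty : ∀ i → ∃ λ v → part v ≡ i
      resolves : ∀ u v → u ≢ v →
                 ∃ λ i → ∃ λ k → ∃ λ l →
                   DistToPart part i u k × DistToPart part i v l × k ≢ l

  IsPartitionDimension : ℕ → Set
  IsPartitionDimension p = ResolvingPartition p × (∀ t → ResolvingPartition t → p ≤ t)

  NontrivialComponent : V → Set
  NontrivialComponent v = ∃ λ w → w ≢ v × Reach v w

  -- H has exactly α connected components of order greater than one:
  -- r picks one representative in each such component.
  NumNontrivialComponents : ℕ → Set
  NumNontrivialComponents α =
    Σ (Fin α → V) λ r →
      (∀ i → NontrivialComponent (r i)) ×
      (∀ i j → Reach (r i) (r j) → i ≡ j) ×
      (∀ v → NontrivialComponent v → ∃ λ i → Reach v (r i))

numIsolated : ∀ {n} → Graph (Fin n) → ℕ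
numIsolated {n} H =
  length (filter (λ v → all? (λ w → adj H v w BoolP.≟ false)) (L.allFin n))

-- Corona product G ⊙ H. Vertex inj₁ i is v_i of G; inj₂ (i , h) is vertex h of the copy H_i.
eqF : ∀ {n} → Fin n → Fin n → Bool
eqF i j = does (i ≟F j)

eqF-sym : ∀ {n} (i j : Fin n) → eqF i j ≡ eqF j i
eqF-sym i j with i ≟F j | j ≟F i
... | yes _ | yes _ = refl
... | no _  | no _  = refl
... | yes p | no q  = Data.Empty.⊥-elim (q (sym p))
  where import Data.Empty
... | no p  | yes q = Data.Empty.⊥-elim (p (sym q))
  where import Data.Empty

coronaAdj : ∀ {n₁ n₂} → Graph (Fin n₁) → Graph (Fin n₂) →
            Fin n₁ ⊎ (Fin n₁ × Fin n₂) → Fin n₁ ⊎ (Fin n₁ × Fin n₂) → Bool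
coronaAdj G H (inj₁ i) (inj₁ j) = adj G i j
coronaAdj G H (inj₁ i) (inj₂ (j , h)) = eqF i j
coronaAdj G H (inj₂ (i , h)) (inj₁ j) = eqF i j
coronaAdj G H (inj₂ (i , h)) (inj₂ (j , k)) = eqF i j ∧ adj H h k

corona : ∀ {n₁ n₂} → Graph (Fin n₁) → Graph (Fin n₂) → Graph (Fin n₁ ⊎ (Fin n₁ × Fin n₂))
corona G H = record
  { adj = coronaAdj G H
  ; adj-sym = sy
  ; adj-irrefl = irr
  }
  where
  sy : ∀ u v → coronaAdj G H u v ≡ coronaAdj G H v u
  sy (inj₁ i) (inj₁ j) = adj-sym G i j
  sy (inj₁ i) (inj₂ (j , h)) = eqF-sym i j
  sy (inj₂ (i , h)) (inj₁ j) = eqF-sym i j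
  sy (inj₂ (i , h)) (inj₂ (j , k)) rewrite eqF-sym i j | adj-sym H h k = refl
  irr : ∀ v → coronaAdj G H v v ≡ false
  irr (inj₁ i) = adj-irrefl G i
  irr (inj₂ (i , h)) rewrite adj-irrefl H h = BoolP.∧-zeroʳ (eqF i i)

module Submission where

-- Fix a resolving partition {A_1,…,A_p} of G and an onto labelling
-- c : V(H) → {1,…,m}.  In G ⊙ H put v_i into the class of A_a(i) and the
-- vertex h of the copy H_i into a new class B_c(h).  The distance from a
-- vertex to an A-class is its depth (0 in G, 1 in a copy) plus the G-distance
-- from its base vertex v_i, so the A-classes resolve vertices with different
-- base vertices, and vertices in different classes are resolved by their own
-- class.  Two vertices h ≠ h' of one copy with c h = c h' are resolved by a
-- B-class at distance 1 from h and at least 2 from h'; such a class exists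
-- when the labelling is separating.  Hence pd(G ⊙ H) ≤ pd(G) + m.
-- Separating labellings with m = n₂ − s arise by collapsing a collapsible set
-- of s+1 vertices of H to one label.  The three cases of the corollary
-- collapse: the α component representatives together with an isolated
-- vertex; the α representatives alone; a single vertex.

open import Defs
open import Data.Nat using (ℕ; zero; suc; _+_; _∸_; _≤_; z≤n; s≤s)
open import Data.Nat.Properties using (≤-trans; ≤-antisym; ≤-reflexive; ≤-<-trans; <⇒≢; n≤1+n; m≤n⇒m≤1+n; +-monoʳ-≤; +-cancelˡ-≡; +-comm; +-assoc; +-suc; +-identityʳ; m+n∸n≡m)
open import Data.Bool using (true; false; _∧_)
open import Data.Bool.Properties using (∧-conicalˡ; ∧-conicalʳ; ¬-not) renaming (_≟_ to _≟ᵇ_)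
open import Data.Fin using (Fin; zero; suc; _↑ˡ_; _↑ʳ_; splitAt; punchIn; punchOut)
open import Data.Fin.Properties using (_≟_; any?; all?; suc-injective; ↑ˡ-injective; ↑ʳ-injective; splitAt-↑ˡ; splitAt-↑ʳ; join-splitAt; punchOut-cong; punchOut-injective; punchOut-punchIn; punchInᵢ≢i)
open import Data.Vec.Functional using () renaming (_∷_ to _◂_)
open import Data.List using ([]; _∷_; length; filter; allFin)
open import Data.Sum using (_⊎_; inj₁; inj₂)
open import Data.Product using (Σ; ∃; _×_; _,_; proj₁; proj₂)
open import Data.Empty using (⊥-elim)
open import Function using (_∘_)
open import Relation.Nullary using (¬_; Dec; yes; no)
open import Relation.Nullary.Decidable using (_×-dec_; dec-true)
open import Relation.Unary using (Decidable)
open import Relation.Binary.PropositionalEquality using (_≡_; _≢_; refl; sym; trans; cong; subst)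

eqF-refl : ∀ {n} (i : Fin n) → eqF i i ≡ true
eqF-refl i = dec-true (i ≟ i) refl

eqF⇒≡ : ∀ {n} (i j : Fin n) → eqF i j ≡ true → i ≡ j
eqF⇒≡ i j e with i ≟ j
eqF⇒≡ i j e  | yes i≡j = i≡j
eqF⇒≡ i j () | no _

↑ˡ≢↑ʳ : ∀ {p m} (i : Fin p) (j : Fin m) → i ↑ˡ m ≢ p ↑ʳ j
↑ˡ≢↑ʳ {p} {m} i j e with trans (sym (splitAt-↑ˡ p i m)) (trans (cong (splitAt p) e) (splitAt-↑ʳ p m j))
... | ()

∸-≤-∸suc+1 : ∀ n s → n ∸ s ≤ n ∸ suc s + 1
∸-≤-∸suc+1 zero    zero    = z≤n
∸-≤-∸suc+1 zero    (suc s) = z≤n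
∸-≤-∸suc+1 (suc n) zero    = ≤-reflexive (+-comm 1 n)
∸-≤-∸suc+1 (suc n) (suc s) = ∸-≤-∸suc+1 n s

-- Least number principle for a decidable predicate with a known witness;
-- it turns "some walk of length n reaches the class" into a distance.
least : (P : ℕ → Set) → (∀ k → Dec (P k)) → ∀ n → P n → ∃ λ k → P k × (∀ m → P m → k ≤ m)
least P P? n pn with P? 0
... | yes p0 = 0 , p0 , λ _ _ → z≤n
least P P? zero    pn | no ¬p0 = ⊥-elim (¬p0 pn)
least P P? (suc n) pn | no ¬p0 with least (P ∘ suc) (P? ∘ suc) n pn
... | k , pk , minimal = suc k , pk , λ { zero pm → ⊥-elim (¬p0 pm) ; (suc m) pm → s≤s (minimal m pm) }

filter-witness : ∀ {A : Set} {P : A → Set} (P? : Decidable P) xs → 1 ≤ length (filter P? xs) → ∃ P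
filter-witness P? [] ()
filter-witness P? (x ∷ xs) nonempty with P? x
... | yes px = x , px
... | no _   = filter-witness P? xs nonempty

_++ʷ_ : ∀ {V} {Γ : Graph V} {u v w k l} → Walk Γ u v k → Walk Γ v w l → Walk Γ u w (k + l)
here _   ++ʷ q = q
step a p ++ʷ q = step a (p ++ʷ q)

has-neighbour : ∀ {V} (Γ : Graph V) {v} → NontrivialComponent Γ v → ∃ λ w → adj Γ v w ≡ true
has-neighbour Γ (w , w≢v , (_ , here _))          = ⊥-elim (w≢v refl)
has-neighbour Γ (_ , _   , (_ , step {w = w} a _)) = w , a

-- An onto labelling c separates h from h' if some label
-- l ≠ c h is carried by a neighbour of h but by no neighbour of h'; then in
-- G ⊙ H the class of label l is at distance 1 from h and ≥ 2 from h'.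
Onto : ∀ {n m} → (Fin n → Fin m) → Set
Onto c = ∀ l → ∃ λ h → c h ≡ l

Separates : ∀ {n m} (H : Graph (Fin n)) → (Fin n → Fin m) → Fin n → Fin n → Set
Separates H c h h' =
  ∃ λ l → l ≢ c h × (∃ λ x → c x ≡ l × adj H h x ≡ true) × (∀ x → c x ≡ l → adj H h' x ≡ false)

record SeparatingLabelling {n} (H : Graph (Fin n)) (m : ℕ) : Set where
  field
    label      : Fin n → Fin m
    onto       : Onto label
    separating : ∀ h h' → h ≢ h' → label h ≡ label h' →
                 Separates H label h h' ⊎ Separates H label h' h

module Corona {n₁ n₂ : ℕ} (G : Graph (Fin n₁)) (H : Graph (Fin n₂)) (G-connected : Connected G) where

  V : Set
  V = Fin n₁ ⊎ (Fin n₁ × Fin n₂)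

  G⊙H : Graph V
  G⊙H = corona G H

  base : V → Fin n₁
  base (inj₁ i)       = i
  base (inj₂ (i , _)) = i

  depth : V → ℕ
  depth (inj₁ _) = 0
  depth (inj₂ _) = 1

  -- A walk ending in G projects to a G-walk from the base vertex, shorter by
  -- at least the depth: the copies give no shortcuts between vertices of G.
  project : ∀ {x j m} → Walk G⊙H x (inj₁ j) m → ∃ λ m' → Walk G (base x) j m' × depth x + m' ≤ m
  project (here _) = 0 , here _ , z≤n
  project {inj₁ i} (step {w = inj₁ w} a W) with project W
  ... | m' , W' , le = suc m' , step a W' , s≤s le
  project {inj₁ i} (step {w = inj₂ (w , _)} a W) with project W
  ... | m' , W' , le = m' , subst (λ z → Walk G z _ m') (sym (eqF⇒≡ i w a)) W' , ≤-trans (n≤1+n m') (m≤n⇒m≤1+n le)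
  project {inj₂ (i , _)} (step {w = inj₁ w} a W) with project W
  ... | m' , W' , le = m' , subst (λ z → Walk G z _ m') (sym (eqF⇒≡ i w a)) W' , s≤s le
  project {inj₂ (i , _)} (step {w = inj₂ (w , _)} a W) with project W
  ... | m' , W' , le = m' , subst (λ z → Walk G z _ m') (sym (eqF⇒≡ i w (∧-conicalˡ (eqF i w) _ a))) W' , m≤n⇒m≤1+n le

  embed : ∀ {i j k} → Walk G i j k → Walk G⊙H (inj₁ i) (inj₁ j) k
  embed (here _)   = here _
  embed (step a W) = step a (embed W)

  descend : ∀ x → Walk G⊙H x (inj₁ (base x)) (depth x)
  descend (inj₁ i)       = here _
  descend (inj₂ (i , _)) = step (eqF-refl i) (here _)

  ascend : ∀ x → Walk G⊙H (inj₁ (base x)) x (depth x)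
  ascend (inj₁ i)       = here _
  ascend (inj₂ (i , _)) = step (eqF-refl i) (here _)

  connected : Connected G⊙H
  connected x y with G-connected (base x) (base y)
  ... | _ , W = _ , (descend x ++ʷ (embed W ++ʷ ascend y))

  -- Reaching a class of a partition in exactly k steps is decidable, so
  -- every vertex has a distance to every nonempty class.
  any-vertex? : {P : V → Set} → (∀ v → Dec (P v)) → Dec (∃ P)
  any-vertex? {P} P? with any? (λ i → P? (inj₁ i)) | any? (λ i → any? (λ h → P? (inj₂ (i , h))))
  ... | yes (i , q)     | _                 = yes (inj₁ i , q)
  ... | no _            | yes (i , h , q)   = yes (inj₂ (i , h) , q)
  ... | no ¬in-G        | no ¬in-copies     =
    no λ { (inj₁ i , q) → ¬in-G (i , q) ; (inj₂ (i , h) , q) → ¬in-copies (i , h , q) }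

  reaches-in? : ∀ {t} (part : V → Fin t) cl k v → Dec (∃ λ u → part u ≡ cl × Walk G⊙H v u k)
  reaches-in? part cl zero v with part v ≟ cl
  ... | yes e  = yes (v , e , here v)
  ... | no ¬e  = no λ { (u , e , here _) → ¬e e }
  reaches-in? part cl (suc k) v with any-vertex? (λ w → (adj G⊙H v w ≟ᵇ true) ×-dec reaches-in? part cl k w)
  ... | yes (w , a , u , e , W) = yes (u , e , step a W)
  ... | no ¬step                = no λ { (u , e , step {w = w} a W) → ¬step (w , a , u , e , W) }

  distance-exists : ∀ {t} (part : V → Fin t) cl v → (∃ λ u → part u ≡ cl) → ∃ λ k → DistToPart G⊙H part cl v k
  distance-exists part cl v (u , e) with connected v u
  ... | n , W with least (λ k → ∃ λ u → part u ≡ cl × Walk G⊙H v u k) (λ k → reaches-in? part cl k v) n (u , e , W)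
  ... | k , reach , minimal = k , reach , λ u m e W → minimal m (u , e , W)

  Resolved : ∀ {t} (part : V → Fin t) → V → V → Set
  Resolved part u v =
    ∃ λ i → ∃ λ k → ∃ λ l → DistToPart G⊙H part i u k × DistToPart G⊙H part i v l × k ≢ l

  resolved-by-own-class : ∀ {t} (part : V → Fin t) u v → part u ≢ part v → Resolved part u v
  resolved-by-own-class part u v ne with distance-exists part (part u) v (u , refl)
  ... | l , D = part u , 0 , l , ((u , refl , here u) , λ _ _ _ _ → z≤n) , D , positive (proj₁ D)
    where
    positive : ∀ {l} → (∃ λ u' → part u' ≡ part u × Walk G⊙H v u' l) → 0 ≢ l
    positive (u' , e , here _)   refl = ne (sym e)
    positive (u' , e , step _ _) ()

  -- The corona partition built from a resolving partition a of G and a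
  -- separating labelling of H; i₀ names a copy witnessing that the new
  -- classes are nonempty.
  module Lift {p m : ℕ} (ΠG : ResolvingPartition G p) (L : SeparatingLabelling H m) (i₀ : Fin n₁) where
    open ResolvingPartition ΠG renaming (part to a; nonempty to a-nonempty; resolves to a-resolves)
    open SeparatingLabelling L renaming (label to c)

    part : V → Fin (p + m)
    part (inj₁ i)       = a i ↑ˡ m
    part (inj₂ (_ , h)) = p ↑ʳ c h

    nonempty : ∀ cl → ∃ λ u → part u ≡ cl
    nonempty cl with splitAt p cl | join-splitAt p m cl
    ... | inj₁ x | e with a-nonempty x
    ...   | j , ej = inj₁ j , trans (cong (_↑ˡ m) ej) e
    nonempty cl | inj₂ y | e with onto y
    ...   | h , eh = inj₂ (i₀ , h) , trans (cong (p ↑ʳ_) eh) e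

    distance-to-G-class : ∀ x cl k → DistToPart G a cl (base x) k →
                          ∀ kc → DistToPart G⊙H part (cl ↑ˡ m) x kc → kc ≡ depth x + k
    distance-to-G-class x cl k ((u , e , W) , minG) kc ((u' , e' , W') , minC) =
      ≤-antisym (minC (inj₁ u) (depth x + k) (cong (_↑ˡ m) e) (descend x ++ʷ embed W)) (lower-bound u' e' W')
      where
      lower-bound : ∀ u' → part u' ≡ cl ↑ˡ m → Walk G⊙H x u' kc → depth x + k ≤ kc
      lower-bound (inj₁ j) e' W' with project W'
      ... | m' , W'' , le = ≤-trans (+-monoʳ-≤ (depth x) (minG j m' (↑ˡ-injective m _ _ e') W'')) le
      lower-bound (inj₂ (_ , h)) e' W' = ⊥-elim (↑ˡ≢↑ʳ cl (c h) (sym e'))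

    resolved-by-G : ∀ x y → base x ≢ base y → depth x ≡ depth y → Resolved part x y
    resolved-by-G x y ne same-depth with a-resolves (base x) (base y) ne
    ... | cl , k , l , Dx , Dy , k≢l
      with distance-exists part (cl ↑ˡ m) x (nonempty _) | distance-exists part (cl ↑ˡ m) y (nonempty _)
    ... | kc , Dcx | lc , Dcy = cl ↑ˡ m , kc , lc , Dcx , Dcy , λ kc≡lc → k≢l (+-cancelˡ-≡ (depth x) k l
          (trans (sym (distance-to-G-class x cl k Dx kc Dcx))
          (trans kc≡lc (trans (distance-to-G-class y cl l Dy lc Dcy) (cong (_+ l) (sym same-depth))))))

    resolved-by-label : ∀ i h h' → c h ≡ c h' → Separates H c h h' → Resolved part (inj₂ (i , h)) (inj₂ (i , h'))
    resolved-by-label i h h' same (l , l≢ch , (x , cx≡l , h~x) , h'≁l)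
      with distance-exists part (p ↑ʳ l) (inj₂ (i , h)) (nonempty _) | distance-exists part (p ↑ʳ l) (inj₂ (i , h')) (nonempty _)
    ... | kc , Dk | lc , Dl = p ↑ʳ l , kc , lc , Dk , Dl ,
          <⇒≢ (≤-<-trans at-most-1 (at-least-2 (proj₁ (proj₂ (proj₁ Dl))) (proj₂ (proj₂ (proj₁ Dl)))))
      where
      at-most-1 : kc ≤ 1
      at-most-1 = proj₂ Dk (inj₂ (i , x)) 1 (cong (p ↑ʳ_) cx≡l)
                    (step (subst (λ b → b ∧ adj H h x ≡ true) (sym (eqF-refl i)) h~x) (here _))
      at-least-2 : ∀ {lc u'} → part u' ≡ p ↑ʳ l → Walk G⊙H (inj₂ (i , h')) u' lc → 2 ≤ lc
      at-least-2 e (here _) = ⊥-elim (l≢ch (trans (sym (↑ʳ-injective p _ _ e)) (sym same)))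
      at-least-2 e (step {w = inj₁ j} a (here _)) = ⊥-elim (↑ˡ≢↑ʳ _ l e)
      at-least-2 e (step {w = inj₂ (j , x')} a (here _))
        with trans (sym (∧-conicalʳ (eqF i j) _ a)) (h'≁l x' (↑ʳ-injective p _ _ e))
      ... | ()
      at-least-2 e (step a (step b W)) = s≤s (s≤s z≤n)

    resolves : ∀ u v → u ≢ v → Resolved part u v
    resolves (inj₁ i) (inj₁ j) ne = resolved-by-G (inj₁ i) (inj₁ j) (λ e → ne (cong inj₁ e)) refl
    resolves (inj₁ i) (inj₂ (j , h)) _ = resolved-by-own-class part _ _ (↑ˡ≢↑ʳ (a i) (c h))
    resolves (inj₂ (i , h)) (inj₁ j) _ = resolved-by-own-class part _ _ (λ e → ↑ˡ≢↑ʳ (a j) (c h) (sym e))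
    resolves (inj₂ (i , h)) (inj₂ (j , h')) ne with i ≟ j
    ... | no i≢j = resolved-by-G (inj₂ (i , h)) (inj₂ (j , h')) i≢j refl
    ... | yes refl with c h ≟ c h'
    ...   | no labels-differ = resolved-by-own-class part _ _ (λ e → labels-differ (↑ʳ-injective p _ _ e))
    ...   | yes same with separating h h' (λ e → ne (cong (λ z → inj₂ (i , z)) e)) same
    ...     | inj₁ sep = resolved-by-label i h h' same sep
    ...     | inj₂ sep with resolved-by-label i h' h (sym same) sep
    ...       | cl , k , l , D₁ , D₂ , k≢l = cl , l , k , D₂ , D₁ , λ e → k≢l (sym e)

    resolving : ResolvingPartition G⊙H (p + m)
    resolving = record { part = part ; nonempty = nonempty ; resolves = resolves }

module Merge {m : ℕ} (a b : Fin (suc m)) (a≢b : a ≢ b) where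
  merge : Fin (suc m) → Fin m
  merge y with y ≟ b
  ... | yes _   = punchOut {i = b} {j = a} (λ e → a≢b (sym e))
  ... | no y≢b  = punchOut {i = b} {j = y} (λ e → y≢b (sym e))

  IsAOrB : Fin (suc m) → Set
  IsAOrB y = y ≡ a ⊎ y ≡ b

  merge-identifies-only-a-b : ∀ y y' → merge y ≡ merge y' → y ≡ y' ⊎ (IsAOrB y × IsAOrB y')
  merge-identifies-only-a-b y y' e with y ≟ b | y' ≟ b
  ... | yes y≡b | yes y'≡b = inj₁ (trans y≡b (sym y'≡b))
  ... | yes y≡b | no _     = inj₂ (inj₂ y≡b , inj₁ (sym (punchOut-injective {i = b} _ _ e)))
  ... | no _    | yes y'≡b = inj₂ (inj₁ (punchOut-injective {i = b} _ _ e) , inj₂ y'≡b)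
  ... | no _    | no _     = inj₁ (punchOut-injective {i = b} _ _ e)

  merge-onto : ∀ y → merge (punchIn b y) ≡ y
  merge-onto y with punchIn b y ≟ b
  ... | yes e = ⊥-elim (punchInᵢ≢i b y e)
  ... | no _  = trans (punchOut-cong b refl) (punchOut-punchIn b)

InImage : ∀ {s n} → (Fin s → Fin n) → Fin n → Set
InImage f h = ∃ λ j → h ≡ f j

IdentifiesOnly : ∀ {n m} → (Fin n → Fin m) → (Fin n → Set) → Set
IdentifiesOnly c M = ∀ h h' → c h ≡ c h' → h ≡ h' ⊎ (M h × M h')

-- By induction on s, merging
-- the values of the first two points at each step.
collapse : ∀ {n} s (f : Fin (suc s) → Fin n) → (∀ j j' → f j ≡ f j' → j ≡ j') →
           ∃ λ m → m + s ≡ n × Σ (Fin n → Fin m) λ c → Onto c × IdentifiesOnly c (InImage f)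
collapse {n} zero f f-injective = n , +-identityʳ n , (λ h → h) , (λ l → l , refl) , λ h h' e → inj₁ e
collapse {n} (suc s) f f-injective with collapse s (f ∘ suc) (λ j j' e → suc-injective (f-injective _ _ e))
... | zero , _ , c , _ , _ with c (f zero)
...   | ()
collapse {n} (suc s) f f-injective | suc m , m+s≡n , c , c-onto , c-only =
  m , trans (+-suc m s) m+s≡n , merge ∘ c , onto , identifies-only
  where
  first-values-differ : c (f zero) ≢ c (f (suc zero))
  first-values-differ e with c-only _ _ e
  ... | inj₁ e' with f-injective _ _ e'
  ...   | ()
  first-values-differ e | inj₂ ((j , e') , _) with f-injective _ _ e'
  ...   | ()
  open Merge (c (f zero)) (c (f (suc zero))) first-values-differ
  in-tail : ∀ {h} → InImage (f ∘ suc) h → InImage f h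
  in-tail (j , e) = suc j , e
  merged-in-image : ∀ h → IsAOrB (c h) → InImage f h
  merged-in-image h (inj₁ e) with c-only _ _ e
  ... | inj₁ e'      = zero , e'
  ... | inj₂ (q , _) = in-tail q
  merged-in-image h (inj₂ e) with c-only _ _ e
  ... | inj₁ e'      = suc zero , e'
  ... | inj₂ (q , _) = in-tail q
  onto : Onto (merge ∘ c)
  onto l with c-onto (punchIn (c (f (suc zero))) l)
  ... | h , e = h , trans (cong merge e) (merge-onto l)
  identifies-only : IdentifiesOnly (merge ∘ c) (InImage f)
  identifies-only h h' e with merge-identifies-only-a-b _ _ e
  ... | inj₂ (x , y) = inj₂ (merged-in-image h x , merged-in-image h' y)
  ... | inj₁ e' with c-only _ _ e'
  ...   | inj₁ e''     = inj₁ e''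
  ...   | inj₂ (x , y) = inj₂ (in-tail x , in-tail y)

HasNeighbourOutside : ∀ {n} → Graph (Fin n) → (Fin n → Set) → Fin n → Set
HasNeighbourOutside H M h = ∃ λ w → ¬ M w × adj H h w ≡ true

record Collapsible {n} (H : Graph (Fin n)) (M : Fin n → Set) : Set where
  field
    no-common-neighbour : ∀ h h' w → M h → M h' → adj H h w ≡ true → adj H h' w ≡ true → h ≡ h'
    neighbour-outside   : ∀ h h' → M h → M h' → h ≢ h' →
                          HasNeighbourOutside H M h ⊎ HasNeighbourOutside H M h'

-- Collapsing a collapsible set gives a separating labelling: the label of
-- the outside neighbour w of h is carried by w alone, and w is not a
-- neighbour of the other member.
collapse-separates : ∀ {n m} (H : Graph (Fin n)) {M : Fin n → Set} → Collapsible H M →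
                     (c : Fin n → Fin m) → Onto c → IdentifiesOnly c M → SeparatingLabelling H m
collapse-separates H {M} M-collapsible c c-onto c-only =
  record { label = c ; onto = c-onto ; separating = separating }
  where
  open Collapsible M-collapsible
  separated : ∀ h h' → M h → M h' → h ≢ h' → HasNeighbourOutside H M h → Separates H c h h'
  separated h h' Mh Mh' h≢h' (w , ¬Mw , h~w) = c w , cw≢ch , (w , refl , h~w) , h'≁cw
    where
    cw≢ch : c w ≢ c h
    cw≢ch e with c-only _ _ e
    ... | inj₂ (Mw , _) = ¬Mw Mw
    ... | inj₁ refl with trans (sym (adj-irrefl H w)) h~w
    ...   | ()
    h'≁cw : ∀ x → c x ≡ c w → adj H h' x ≡ false
    h'≁cw x e with c-only _ _ e
    ... | inj₂ (_ , Mw) = ⊥-elim (¬Mw Mw)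
    ... | inj₁ refl = ¬-not λ h'~w → h≢h' (no-common-neighbour h h' w Mh Mh' h~w h'~w)
  separating : ∀ h h' → h ≢ h' → c h ≡ c h' → Separates H c h h' ⊎ Separates H c h' h
  separating h h' h≢h' e with c-only _ _ e
  ... | inj₁ h≡h' = ⊥-elim (h≢h' h≡h')
  ... | inj₂ (Mh , Mh') with neighbour-outside h h' Mh Mh' h≢h'
  ...   | inj₁ out = inj₁ (separated h h' Mh Mh' h≢h' out)
  ...   | inj₂ out = inj₂ (separated h' h Mh' Mh (λ e → h≢h' (sym e)) out)

pd-corona-bound : ∀ {n₁ n₂ p q s} (G : Graph (Fin n₁)) (H : Graph (Fin n₂)) → Connected G → Fin n₁ →
                  ResolvingPartition G p → (∀ t → ResolvingPartition (corona G H) t → q ≤ t) →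
                  (f : Fin (suc s) → Fin n₂) → (∀ j j' → f j ≡ f j' → j ≡ j') → Collapsible H (InImage f) →
                  q ≤ p + (n₂ ∸ s)
pd-corona-bound {n₂ = n₂} {p} {q} {s} G H G-connected i₀ ΠG q-minimal f f-injective f-collapsible
  with collapse s f f-injective
... | m , m+s≡n₂ , c , c-onto , c-only =
  subst (λ t → q ≤ p + t) m≡n₂∸s (q-minimal (p + m) (Lift.resolving ΠG labelling i₀))
  where
  open Corona G H G-connected using (module Lift)
  labelling : SeparatingLabelling H m
  labelling = collapse-separates H f-collapsible c c-onto c-only
  m≡n₂∸s : m ≡ n₂ ∸ s
  m≡n₂∸s = trans (sym (m+n∸n≡m m s)) (cong (_∸ s) m+s≡n₂)

singleton-collapsible : ∀ {n} (H : Graph (Fin n)) (v : Fin n) → Collapsible H (InImage {1} (λ _ → v))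
singleton-collapsible H v = record
  { no-common-neighbour = λ { h h' w (_ , refl) (_ , refl) _ _ → refl }
  ; neighbour-outside   = λ { h h' (_ , refl) (_ , refl) h≢h' → ⊥-elim (h≢h' refl) }
  }

module Representatives {n α : ℕ} (H : Graph (Fin n)) (r : Fin α → Fin n)
                       (distinct : ∀ i j → Reach H (r i) (r j) → i ≡ j)
                       (neighbour : ∀ j → ∃ λ w → adj H (r j) w ≡ true) where

  rep-injective : ∀ i j → r i ≡ r j → i ≡ j
  rep-injective i j e = distinct i j (0 , subst (λ z → Walk H (r i) z 0) e (here _))

  reps-share-no-neighbour : ∀ i j w → adj H (r i) w ≡ true → adj H (r j) w ≡ true → i ≡ j
  reps-share-no-neighbour i j w ri~w rj~w =
    distinct i j (2 , step ri~w (step (trans (adj-sym H w (r j)) rj~w) (here _)))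

  neighbour-not-rep : ∀ j w → adj H (r j) w ≡ true → ¬ InImage r w
  neighbour-not-rep j w rj~w (i , refl) with distinct j i (1 , step rj~w (here _))
  ... | refl with trans (sym (adj-irrefl H (r j))) rj~w
  ...   | ()

  reps-collapsible : Collapsible H (InImage r)
  reps-collapsible = record
    { no-common-neighbour = λ { h h' w (i , refl) (j , refl) ri~w rj~w → cong r (reps-share-no-neighbour i j w ri~w rj~w) }
    ; neighbour-outside   = λ { h h' (j , refl) _ _ → inj₁ (outside j) }
    }
    where
    outside : ∀ j → HasNeighbourOutside H (InImage r) (r j)
    outside j = proj₁ (neighbour j) , neighbour-not-rep j _ (proj₂ (neighbour j)) , proj₂ (neighbour j)

  module WithIsolated (z : Fin n) (z-isolated : ∀ w → adj H z w ≡ false) where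
    z≁ : ∀ {w} → adj H z w ≡ true → ∀ {A : Set} → A
    z≁ {w} z~w with trans (sym (z-isolated w)) z~w
    ... | ()

    z≢rep : ∀ j → z ≢ r j
    z≢rep j refl = z≁ (proj₂ (neighbour j))

    z◂r-injective : ∀ j j' → (z ◂ r) j ≡ (z ◂ r) j' → j ≡ j'
    z◂r-injective zero    zero     _ = refl
    z◂r-injective zero    (suc j') e = ⊥-elim (z≢rep j' e)
    z◂r-injective (suc j) zero     e = ⊥-elim (z≢rep j (sym e))
    z◂r-injective (suc j) (suc j') e = cong suc (rep-injective j j' e)

    outside : ∀ j → HasNeighbourOutside H (InImage (z ◂ r)) (r j)
    outside j with neighbour j
    ... | w , rj~w = w , not-in , rj~w
      where
      not-in : ¬ InImage (z ◂ r) w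
      not-in (zero , refl)  = z≁ (trans (adj-sym H z (r j)) rj~w)
      not-in (suc i , w≡ri) = neighbour-not-rep j w rj~w (i , w≡ri)

    no-common : ∀ h h' w → InImage (z ◂ r) h → InImage (z ◂ r) h' →
                adj H h w ≡ true → adj H h' w ≡ true → h ≡ h'
    no-common _ _ _ (zero , refl)  _               z~w _   = z≁ z~w
    no-common _ _ _ (suc _ , refl) (zero , refl)   _   z~w = z≁ z~w
    no-common _ _ w (suc i , refl) (suc j , refl) ri~w rj~w = cong r (reps-share-no-neighbour i j w ri~w rj~w)

    reps+isolated-collapsible : Collapsible H (InImage (z ◂ r))
    reps+isolated-collapsible = record
      { no-common-neighbour = no-common
      ; neighbour-outside   = λ
          { _ _ (suc j , refl) _ _ → inj₁ (outside j)
          ; _ _ _ (suc j , refl) _ → inj₂ (outside j)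
          ; _ _ (zero , refl) (zero , refl) h≢h' → ⊥-elim (h≢h' refl) }
      }

corollary4 : (n₁ n₂ : ℕ) → 2 ≤ n₁ → 2 ≤ n₂ →
    (G : Graph (Fin n₁)) (H : Graph (Fin n₂)) → Connected G →
    (α : ℕ) → NumNontrivialComponents H α →
    (p q : ℕ) → IsPartitionDimension G p → IsPartitionDimension (corona G H) q →
    (1 ≤ α → 1 ≤ numIsolated H → q ≤ p + (n₂ ∸ α)) ×
    (1 ≤ α → numIsolated H ≡ 0 → q ≤ p + (n₂ ∸ α) + 1) ×
    (α ≡ 0 → q ≤ p + n₂)
corollary4 (suc n₁) (suc n₂) _ _ G H G-connected α (r , nontrivial , distinct , _) p q (ΠG , _) (_ , q-minimal) =
  reps+isolated , reps-only , single-vertex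
  where
  bound : ∀ {s} (f : Fin (suc s) → Fin (suc n₂)) → (∀ j j' → f j ≡ f j' → j ≡ j') →
          Collapsible H (InImage f) → q ≤ p + (suc n₂ ∸ s)
  bound = pd-corona-bound G H G-connected zero ΠG q-minimal
  open Representatives H r distinct (λ j → has-neighbour H (nontrivial j))

  reps+isolated : 1 ≤ α → 1 ≤ numIsolated H → q ≤ p + (suc n₂ ∸ α)
  reps+isolated _ β≥1 with filter-witness (λ v → all? (λ w → adj H v w ≟ᵇ false)) (allFin (suc n₂)) β≥1
  ... | z , z-isolated = bound (z ◂ r) z◂r-injective reps+isolated-collapsible
    where open WithIsolated z z-isolated

  -- α ≥ 1: collapse the representatives (this bound does not need β = 0).
  reps-only : 1 ≤ α → numIsolated H ≡ 0 → q ≤ p + (suc n₂ ∸ α) + 1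
  reps-only (s≤s {n = s} z≤n) _ =
    ≤-trans (bound r rep-injective reps-collapsible)
            (≤-trans (+-monoʳ-≤ p (∸-≤-∸suc+1 (suc n₂) s)) (≤-reflexive (sym (+-assoc p _ 1))))

  single-vertex : α ≡ 0 → q ≤ p + suc n₂
  single-vertex _ = bound (λ _ → zero) (λ { zero zero _ → refl ; (suc ()) _ _ ; _ (suc ()) _ }) (singleton-collapsible H zero)
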